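{- If $\sigma$ and $\rho$ are permutations and $\sigma$ is contained in $\rho$, then $\rho$ has at least as many separated pairs as $\sigma$.
   Context: A permutation $\rho=\rho_1\cdots\rho_n$ contains $\sigma=\sigma_1\cdots\sigma_k$ if there are indices $\alpha_1<\cdots<\alpha_k$ with $\rho_{\alpha_i}<\rho_{\alpha_j}$ iff $\sigma_i<\sigma_j$. For a permutation $\pi$ of $\{1,\dots,n\}$ and $1\le i\le n-1$, $(i+1,i)$ is a separated pair of $\pi$ if $\pi$ contains a subsequence $(i+1,k,i)$ (in this order of positions) with $k>i+1$. -}

module Defs where

open import Data.Nat as ℕ using (ℕ; suc; _≤_)
open import Data.Fin as Fin using (Fin; toℕ)
open import Data.Fin.Properties using (any?)
open import Data.Product using (Σ; ∃; _×_; _,_)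
open import Data.List using (List; length; filter; upTo)
open import Function.Definitions using (Injective)
open import Relation.Binary.PropositionalEquality using (_≡_)
open import Relation.Nullary using (Dec)
open import Relation.Nullary.Decidable using (_×-dec_)
open import Relation.Nullary.Negation using (¬_)
import Data.Nat.Properties as ℕP
import Data.Fin.Properties as FinP

-- A permutation of size n, as an injective (hence bijective) map Fin n → Fin n.
-- Positions and values are 0-indexed: ρ_{α+1} = 1 + toℕ (fun ρ α).
record Perm (n : ℕ) : Set where
  field
    fun : Fin n → Fin n
    inj : Injective _≡_ _≡_ fun
open Perm public

Contains : ∀ {n k} → Perm n → Perm k → Set
Contains {n} {k} ρ σ =
  Σ (Fin k → Fin n) λ α →
    (∀ i j → i Fin.< j → α i Fin.< α j) ×
    (∀ i j → (fun ρ (α i) Fin.< fun ρ (α j) → fun σ i Fin.< fun σ j) ×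
             (fun σ i Fin.< fun σ j → fun ρ (α i) Fin.< fun ρ (α j)))

-- (i+1, i) is a separated pair of π, written with v = i - 1 (0-indexed values
-- v+1 and v): there are positions p < q < r with π_p = v+1, π_r = v, π_q > v+1.
IsSeparated : ∀ {n} → Perm n → ℕ → Set
IsSeparated {n} π v =
  ∃ λ (p : Fin n) → ∃ λ (q : Fin n) → ∃ λ (r : Fin n) →
    (p Fin.< q) × (q Fin.< r) ×
    (toℕ (fun π p) ≡ suc v) × (toℕ (fun π r) ≡ v) × (suc v ℕ.< toℕ (fun π q))

isSeparated? : ∀ {n} (π : Perm n) (v : ℕ) → Dec (IsSeparated π v)
isSeparated? {n} π v =
  any? λ p → any? λ q → any? λ r →
    (p FinP.<? q) ×-dec (q FinP.<? r) ×-dec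
    (toℕ (fun π p) ℕP.≟ suc v) ×-dec (toℕ (fun π r) ℕP.≟ v) ×-dec
    (suc v ℕP.<? toℕ (fun π q))

-- Number of separated pairs of π (every separated pair has v < n, so
-- ranging v over 0..n-1 counts all of them).
numSeparated : ∀ {n} → Perm n → ℕ
numSeparated {n} π = length (filter (isSeparated? π) (upTo n))

-- An occurrence of σ in ρ carries each separated pair (v+1, v) of σ, at positions p < q < r, to a
-- 231-pattern ρ_{α r} < ρ_{α p} < ρ_{α q} of ρ. Walking up from the value ρ_{α r}: the value one
-- larger either sits left of α q, which gives a separated pair, or right of it, and the same step is
-- repeated from there; the walk must stop before reaching ρ_{α p}, which sits left of α q. So every
-- such 231-pattern contains a separated pair of ρ in the value interval [ρ_{α r}, ρ_{α p}). These
-- intervals are disjoint and ordered like the pairs of σ, so the induced map on pairs is strictly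
-- increasing.
module Submission where

open import Defs
open import Data.Nat using (ℕ; zero; suc; _+_; _≤_; _<_; z≤n; s≤s)
import Data.Nat.Properties as ℕP
open ℕP.≤-Reasoning
open import Data.Fin as Fin using (Fin; toℕ; fromℕ<; punchOut)
import Data.Fin.Properties as FinP
open import Data.Product using (∃; _×_; _,_; proj₁; proj₂)
open import Data.List using (length; filter; upTo; _++_; [_])
import Data.List.Properties as ListP
open import Data.Sum using (inj₁; inj₂)
open import Function using (_∘_)
open import Level using (0ℓ)
open import Relation.Binary.PropositionalEquality
  using (_≡_; _≢_; refl; sym; trans; cong; subst; subst₂)
open import Relation.Binary.Definitions using (tri<; tri≈; tri>)
open import Relation.Nullary using (yes; no; ¬_)
open import Relation.Nullary.Negation using (contradiction)
open import Relation.Unary using (Pred; Decidable)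

module _ {P : Pred ℕ 0ℓ} (P? : Decidable P) where

  count : ℕ → ℕ
  count m = length (filter P? (upTo m))

  count-suc : ∀ m → count (suc m) ≡ count m + length (filter P? [ m ])
  count-suc m = begin-equality
    length (filter P? (upTo (suc m)))              ≡⟨ cong (length ∘ filter P?) (sym (ListP.upTo-∷ʳ m)) ⟩
    length (filter P? (upTo m ++ [ m ]))           ≡⟨ cong length (ListP.filter-++ P? (upTo m) [ m ]) ⟩
    length (filter P? (upTo m) ++ filter P? [ m ]) ≡⟨ ListP.length-++ (filter P? (upTo m)) ⟩
    count m + length (filter P? [ m ])             ∎

  count-suc-accept : ∀ {m} → P m → count (suc m) ≡ suc (count m)
  count-suc-accept {m} Pm = begin-equality
    count (suc m)                      ≡⟨ count-suc m ⟩
    count m + length (filter P? [ m ]) ≡⟨ cong (λ xs → count m + length xs) (ListP.filter-accept P? Pm) ⟩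
    count m + 1                        ≡⟨ ℕP.+-comm (count m) 1 ⟩
    suc (count m)                      ∎

  count-suc-reject : ∀ {m} → ¬ P m → count (suc m) ≡ count m
  count-suc-reject {m} ¬Pm = begin-equality
    count (suc m)                      ≡⟨ count-suc m ⟩
    count m + length (filter P? [ m ]) ≡⟨ cong (λ xs → count m + length xs) (ListP.filter-reject P? ¬Pm) ⟩
    count m + 0                        ≡⟨ ℕP.+-identityʳ (count m) ⟩
    count m                            ∎

  count-≤-suc : ∀ m → count m ≤ count (suc m)
  count-≤-suc m with P? m
  ... | yes Pm = ℕP.≤-trans (ℕP.n≤1+n (count m)) (ℕP.≤-reflexive (sym (count-suc-accept Pm)))
  ... | no ¬Pm = ℕP.≤-reflexive (sym (count-suc-reject ¬Pm))

  count-mono : ∀ {m n} → m ≤ n → count m ≤ count n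
  count-mono {n = zero} z≤n = ℕP.≤-refl
  count-mono {n = suc n} m≤1+n with ℕP.m≤n⇒m<n∨m≡n m≤1+n
  ... | inj₁ m<1+n = ℕP.≤-trans (count-mono (ℕP.≤-pred m<1+n)) (count-≤-suc n)
  ... | inj₂ refl  = ℕP.≤-refl

module _ {P Q : Pred ℕ 0ℓ} (P? : Decidable P) (Q? : Decidable Q) (f : ∀ {v} → P v → ℕ)
         (increasing : ∀ {v w} (Pv : P v) (Pw : P w) → v < w → f Pv < f Pw) where

  count-≤-of-increasing-map :
    ∀ k n → (∀ {v} (Pv : P v) → v < k → f Pv < n × Q (f Pv)) → count P? k ≤ count Q? n
  count-≤-of-increasing-map zero n maps = z≤n
  count-≤-of-increasing-map (suc k) n maps with P? k
  ... | no ¬Pk = begin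
    count P? (suc k) ≡⟨ count-suc-reject P? ¬Pk ⟩
    count P? k       ≤⟨ count-≤-of-increasing-map k n (λ Pv v<k → maps Pv (ℕP.m<n⇒m<1+n v<k)) ⟩
    count Q? n       ∎
  ... | yes Pk with maps Pk (ℕP.n<1+n k)
  ...   | fk<n , Qfk = begin
    count P? (suc k)      ≡⟨ count-suc-accept P? Pk ⟩
    suc (count P? k)      ≤⟨ s≤s (count-≤-of-increasing-map k (f Pk) below-fk) ⟩
    suc (count Q? (f Pk)) ≡⟨ count-suc-accept Q? Qfk ⟨
    count Q? (suc (f Pk)) ≤⟨ count-mono Q? fk<n ⟩
    count Q? n            ∎
    where
    below-fk : ∀ {v} (Pv : P v) → v < k → f Pv < f Pk × Q (f Pv)
    below-fk Pv v<k = increasing Pv Pk v<k , proj₂ (maps Pv (ℕP.m<n⇒m<1+n v<k))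

value : ∀ {n} → Perm n → Fin n → ℕ
value π i = toℕ (fun π i)

value-injective : ∀ {n} (π : Perm n) {i j} → value π i ≡ value π j → i ≡ j
value-injective π = inj π ∘ FinP.toℕ-injective

-- If y had no preimage, punching y out of the codomain would inject Fin (suc m) into Fin m.
perm-surjective : ∀ {n} (π : Perm n) (y : Fin n) → ∃ λ x → fun π x ≡ y
perm-surjective {suc m} π y with FinP.any? (λ x → fun π x FinP.≟ y)
... | yes preimage = preimage
... | no ∄preimage = contradiction (FinP.injective⇒≤ punchOut-y∘π-injective) ℕP.1+n≰n
  where
  y≢π : ∀ x → y ≢ fun π x
  y≢π x y≡πx = ∄preimage (x , sym y≡πx)

  punchOut-y∘π-injective : ∀ {a b} → punchOut (y≢π a) ≡ punchOut (y≢π b) → a ≡ b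
  punchOut-y∘π-injective = inj π ∘ FinP.punchOut-injective (y≢π _) (y≢π _)

value-suc-attained : ∀ {n} (π : Perm n) {i j} → value π i < value π j →
                     ∃ λ s → value π s ≡ suc (value π i)
value-suc-attained π {i} {j} i<j =
  let s , πs≡y = perm-surjective π (fromℕ< 1+i<n) in s , trans (cong toℕ πs≡y) (FinP.toℕ-fromℕ< 1+i<n)
  where
  1+i<n : suc (value π i) < _
  1+i<n = ℕP.≤-<-trans i<j (FinP.toℕ<n (fun π j))

record SeparatedIn {n} (π : Perm n) (lo hi : ℕ) : Set where
  constructor separatedIn
  field
    pair       : ℕ
    lo≤pair    : lo ≤ pair
    pair<hi    : pair < hi
    separated  : IsSeparated π pair

separated-in-231 : ∀ {n} (π : Perm n) {p q r} → p Fin.< q → q Fin.< r →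
                   value π r < value π p → value π p < value π q →
                   SeparatedIn π (value π r) (value π p)
separated-in-231 π {p} {q} p<q q<r r<p p<q′ = walk _ (proj₂ (ℕP.m≤n⇒∃[o]m+o≡n r<p)) q<r
  where
  below : ∀ {a b} d → suc a + d ≡ b → a < b
  below {a} d gap = subst (suc a ≤_) gap (ℕP.m≤m+n (suc a) d)

  shift : ∀ a d → suc (suc a) + d ≡ suc a + suc d
  shift a d = cong suc (sym (ℕP.+-suc a d))

  walk : ∀ d {r} → suc (value π r) + d ≡ value π p → q Fin.< r →
         SeparatedIn π (value π r) (value π p)
  walk d {r} gap q<r with value-suc-attained π (below d gap)
  ... | s , πs≡1+πr with FinP.<-cmp s q
  ... | tri< s<q _ _  = separatedIn (value π r) ℕP.≤-refl (below d gap)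
                          (s , q , r , s<q , q<r , πs≡1+πr , refl , ℕP.≤-<-trans (below d gap) p<q′)
  ... | tri≈ _ refl _ = contradiction (sym πs≡1+πr) (ℕP.<⇒≢ (ℕP.≤-<-trans (below d gap) p<q′))
  ... | tri> _ _ q<s with d
  ...   | zero = contradiction (subst (p Fin.<_) s≡p (FinP.<-trans p<q q<s)) (ℕP.n≮n _)
    where
    s≡p : s ≡ p
    s≡p = value-injective π (trans πs≡1+πr (trans (sym (ℕP.+-identityʳ _)) gap))
  ...   | suc d′ with walk d′ (trans (cong (λ x → suc x + d′) πs≡1+πr) (trans (shift _ d′) gap)) q<s
  ...     | separatedIn w πs≤w w<πp separated =
    separatedIn w (ℕP.<⇒≤ (subst (_≤ w) πs≡1+πr πs≤w)) w<πp separated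

module _ {n k} (ρ : Perm n) (σ : Perm k) (occurrence : Contains ρ σ) where

  α : Fin k → Fin n
  α = proj₁ occurrence

  α-increasing : ∀ {i j} → i Fin.< j → α i Fin.< α j
  α-increasing = proj₁ (proj₂ occurrence) _ _

  α-preserves-< : ∀ {i j} → value σ i < value σ j → value ρ (α i) < value ρ (α j)
  α-preserves-< = proj₂ (proj₂ (proj₂ occurrence) _ _)

  α-preserves-≤ : ∀ {i j} → value σ i ≤ value σ j → value ρ (α i) ≤ value ρ (α j)
  α-preserves-≤ σi≤σj with ℕP.m≤n⇒m<n∨m≡n σi≤σj
  ... | inj₁ σi<σj = ℕP.<⇒≤ (α-preserves-< σi<σj)
  ... | inj₂ σi≡σj rewrite value-injective σ σi≡σj = ℕP.≤-refl

  top bottom : ∀ {v} → IsSeparated σ v → Fin k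
  top (p , _) = p
  bottom (_ , _ , r , _) = r

  image : ∀ {v} (s : IsSeparated σ v) → SeparatedIn ρ (value ρ (α (bottom s))) (value ρ (α (top s)))
  image (p , q , r , p<q , q<r , σp≡1+v , σr≡v , 1+v<σq) =
    separated-in-231 ρ (α-increasing p<q) (α-increasing q<r)
      (α-preserves-< (subst₂ _<_ (sym σr≡v) (sym σp≡1+v) (ℕP.n<1+n _)))
      (α-preserves-< (subst (_< value σ q) (sym σp≡1+v) 1+v<σq))

  image-pair : ∀ {v} → IsSeparated σ v → ℕ
  image-pair = SeparatedIn.pair ∘ image

  image-pair-increasing : ∀ {v v′} (s : IsSeparated σ v) (t : IsSeparated σ v′) → v < v′ →
                          image-pair s < image-pair t
  image-pair-increasing s@(_ , _ , _ , _ , _ , σp≡1+v , _) t@(_ , _ , _ , _ , _ , _ , σr≡v′ , _) v<v′ =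
    begin-strict
      image-pair s           <⟨ SeparatedIn.pair<hi (image s) ⟩
      value ρ (α (top s))    ≤⟨ α-preserves-≤ (subst₂ _≤_ (sym σp≡1+v) (sym σr≡v′) v<v′) ⟩
      value ρ (α (bottom t)) ≤⟨ SeparatedIn.lo≤pair (image t) ⟩
      image-pair t           ∎

proposition2p6 : ∀ {n k} (ρ : Perm n) (σ : Perm k) →
    Contains ρ σ → numSeparated σ ≤ numSeparated ρ
proposition2p6 {n} {k} ρ σ occurrence =
  count-≤-of-increasing-map (isSeparated? σ) (isSeparated? ρ)
    (image-pair ρ σ occurrence) (image-pair-increasing ρ σ occurrence) k n
    (λ s _ → image-pair<n s , SeparatedIn.separated (image ρ σ occurrence s))
  where
  image-pair<n : ∀ {v} (s : IsSeparated σ v) → image-pair ρ σ occurrence s < n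
  image-pair<n s = ℕP.<-trans (SeparatedIn.pair<hi (image ρ σ occurrence s)) (FinP.toℕ<n _)
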